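{- For every $d\ge1$, the number of edges of the Hasse diagram of the Mockingbird lattice $\mathrm{M}(d)$ is $\mathbf{a}(d-1)$, where $\mathbf{a}(0)=0$ and, for $n\ge1$, $\mathbf{a}(n) = \mathbf{a}(n-1) + \mathbf{b}(n-1) + 2\,\mathbf{a}(n-1)\,\mathbf{b}(n-1)$, with $\mathbf{b}(0)=1$ and $\mathbf{b}(n) = \mathbf{b}(n-1)+\mathbf{b}(n-1)^2$ for $n\ge 1$.
   Context: Terms over $\{{\rm M}\}$: the smallest set containing variables $\mathsf{x}_1,\mathsf{x}_2,\dots$, the symbol ${\rm M}$, and $(\mathfrak{t}_1\mathfrak{t}_2)$ for terms $\mathfrak{t}_1,\mathfrak{t}_2$ (application associates to the left). $\Rightarrow$ is the smallest relation with ${\rm M}\,\mathfrak{s}\Rightarrow\mathfrak{s}\,\mathfrak{s}$ for all terms $\mathfrak{s}$, closed under $\mathfrak{t}_1\Rightarrow\mathfrak{t}_1'$ implies $\mathfrak{t}_1\mathfrak{t}_2\Rightarrow\mathfrak{t}_1'\mathfrak{t}_2$ and $\mathfrak{t}_2\mathfrak{t}_1\Rightarrow\mathfrak{t}_2\mathfrak{t}_1'$; $\preccurlyeq$ is its reflexive-transitive closure (a partial order). With $\mathfrak{r}_0={\rm M}$ and $\mathfrak{r}_d = {\rm M}\,\mathfrak{r}_{d-1}$, the Mockingbird lattice $\mathrm{M}(d)$ is the set $\{\mathfrak{t} : \mathfrak{r}_d\preccurlyeq\mathfrak{t}\}$ ordered by $\preccurlyeq$. -}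

module Defs where

open import Data.Nat using (ℕ; zero; suc; _+_; _*_)
open import Data.Product using (_×_; Σ; _,_)
open import Data.Sum using (_⊎_)
open import Data.List using (List; length)
open import Data.List.Membership.Propositional using (_∈_)
open import Data.List.Relation.Unary.Unique.Propositional using (Unique)
open import Relation.Binary.PropositionalEquality using (_≡_)
open import Relation.Nullary using (¬_)
open import Relation.Binary.Construct.Closure.ReflexiveTransitive using (Star)

data Term : Set where
  var : ℕ → Term
  M   : Term
  _·_ : Term → Term → Term

infixl 9 _·_

data _⇒_ : Term → Term → Set where
  mock : ∀ s → (M · s) ⇒ (s · s)
  appL : ∀ {t₁ t₁′} t₂ → t₁ ⇒ t₁′ → (t₁ · t₂) ⇒ (t₁′ · t₂)
  appR : ∀ {t₁ t₁′} t₂ → t₁ ⇒ t₁′ → (t₂ · t₁) ⇒ (t₂ · t₁′)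

_≼_ : Term → Term → Set
_≼_ = Star _⇒_

r : ℕ → Term
r zero    = M
r (suc d) = M · r d

InM : ℕ → Term → Set
InM d t = r d ≼ t

Covers : ℕ → Term → Term → Set
Covers d s t =
  InM d s × InM d t × s ≼ t × ¬ (s ≡ t) ×
  (∀ u → InM d u → s ≼ u → u ≼ t → (u ≡ s) ⊎ (u ≡ t))

HasseEdgeCount : ℕ → ℕ → Set
HasseEdgeCount d n =
  Σ (List (Term × Term)) λ L →
    Unique L ×
    (∀ s t → ((s , t) ∈ L → Covers d s t) × (Covers d s t → (s , t) ∈ L)) ×
    length L ≡ n

b : ℕ → ℕ
b zero    = 1
b (suc n) = b n + b n * b n

a : ℕ → ℕ
a zero    = 0
a (suc n) = a n + b n + 2 * a n * b n

-- Apart from the redex M·u itself, a reduct of an application only rewrites inside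
-- its two arguments, and firing M·u yields u·u. Hence every element of M(d+2) is M·u
-- or u·v with u, v ∈ M(d+1), comparisons between such terms are componentwise, and a
-- cover in M(d+2) is either a cover of M(d+1) placed in one of the contexts M·_, _·v,
-- u·_ (with v, u ∈ M(d+1)), or the firing M·u ⋖ u·u. So if M(d+1) has b(d) elements
-- and a(d) covers, M(d+2) has b(d) + b(d)² elements and a(d) + b(d) + 2 a(d) b(d)
-- covers.
module Submission where

open import Defs
open import Data.Nat using (ℕ; suc; zero; _+_; _*_)
open import Data.Nat.Tactic.RingSolver using (solve-∀)
open import Data.Product using (_×_; _,_; proj₁; proj₂; ∃; ∃₂; ∃-syntax)
open import Data.Sum using (_⊎_; inj₁; inj₂)
import Data.Sum as ⊎
open import Data.Empty using (⊥-elim)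
open import Data.List using (List; []; _∷_; length; map; _++_; cartesianProductWith)
open import Data.List.Properties using (length-map; length-++)
open import Data.List.Membership.Propositional using (_∈_)
open import Data.List.Membership.Propositional.Properties
  using (∈-map⁺; ∈-map⁻; ∈-++⁺ˡ; ∈-++⁺ʳ; ∈-++⁻; ∈-cartesianProductWith⁺; ∈-cartesianProductWith⁻)
open import Data.List.Relation.Unary.Any using (here; there)
open import Data.List.Relation.Unary.All using ([])
open import Data.List.Relation.Unary.AllPairs using ([]; _∷_)
open import Data.List.Relation.Unary.Unique.Propositional using (Unique)
open import Data.List.Relation.Unary.Unique.Propositional.Properties
  using (map⁺; ++⁺; cartesianProductWith⁺)
open import Data.List.Relation.Binary.Disjoint.Propositional using (Disjoint)
open import Function.Definitions using (Injective)
open import Relation.Binary.Core using (_Preserves_⟶_)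
open import Relation.Binary.PropositionalEquality
  using (_≡_; _≢_; refl; sym; trans; cong; cong₂; module ≡-Reasoning)
open import Relation.Nullary using (¬_)
open import Relation.Binary.Construct.Closure.ReflexiveTransitive using (ε; _◅_; _◅◅_; gmap)

M-irreducible : ∀ {t} → ¬ (t ⇒ M)
M-irreducible ()

≼M⇒≡M : ∀ {t} → t ≼ M → t ≡ M
≼M⇒≡M ε = refl
≼M⇒≡M (step ◅ steps) with ≼M⇒≡M steps
... | refl = ⊥-elim (M-irreducible step)

·-injective : ∀ {u v p q} → u · v ≡ p · q → u ≡ p × v ≡ q
·-injective refl = refl , refl

·-monoˡ-≼ : ∀ v → (_· v) Preserves _≼_ ⟶ _≼_
·-monoˡ-≼ v = gmap (_· v) (appL v)

·-monoʳ-≼ : ∀ u → (u ·_) Preserves _≼_ ⟶ _≼_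
·-monoʳ-≼ u = gmap (u ·_) (appR u)

·-mono-≼ : ∀ {u v p q} → u ≼ p → v ≼ q → (u · v) ≼ (p · q)
·-mono-≼ {v = v} {p = p} u≼p v≼q = ·-monoˡ-≼ v u≼p ◅◅ ·-monoʳ-≼ p v≼q

mock-≼ : ∀ {u v w} → u ≼ v → u ≼ w → (M · u) ≼ (v · w)
mock-≼ {u} u≼v u≼w = mock u ◅ ·-mono-≼ u≼v u≼w

data ·-Reduct (u v : Term) : Term → Set where
  reduct : ∀ {p q} → u ≼ p → v ≼ q → ·-Reduct u v (p · q)

·-reduct : ∀ {u v t} → u ≢ M → (u · v) ≼ t → ·-Reduct u v t
·-reduct u≢M ε = reduct ε ε
·-reduct u≢M (mock _ ◅ _) = ⊥-elim (u≢M refl)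
·-reduct u≢M (appL _ step ◅ steps) with ·-reduct (λ { refl → M-irreducible step }) steps
... | reduct u≼p v≼q = reduct (step ◅ u≼p) v≼q
·-reduct u≢M (appR _ step ◅ steps) with ·-reduct u≢M steps
... | reduct u≼p v≼q = reduct u≼p (step ◅ v≼q)

data M·-Reduct (u : Term) : Term → Set where
  unfired : ∀ {u′} → u ≼ u′ → M·-Reduct u (M · u′)
  fired   : ∀ {v w} → u ≼ v → u ≼ w → M·-Reduct u (v · w)

M·-reduct : ∀ {u t} → u ≢ M → (M · u) ≼ t → M·-Reduct u t
M·-reduct _ ε = unfired ε
M·-reduct u≢M (mock _ ◅ steps) with ·-reduct u≢M steps
... | reduct u≼v u≼w = fired u≼v u≼w
M·-reduct _ (appL _ () ◅ _)
M·-reduct u≢M (appR _ step ◅ steps) with M·-reduct (λ { refl → M-irreducible step }) steps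
... | unfired u≼u′ = unfired (step ◅ u≼u′)
... | fired u≼v u≼w = fired (step ◅ u≼v) (step ◅ u≼w)

M·-cancel-≼ : ∀ {u u′} → u ≢ M → (M · u) ≼ (M · u′) → u ≼ u′
M·-cancel-≼ u≢M Mu≼Mu′ with M·-reduct u≢M Mu≼Mu′
... | unfired u≼u′ = u≼u′
... | fired u≼M _ = ⊥-elim (u≢M (≼M⇒≡M u≼M))

M·≼·⇒≼ : ∀ {u v w} → u ≢ M → v ≢ M → (M · u) ≼ (v · w) → u ≼ v × u ≼ w
M·≼·⇒≼ u≢M v≢M Mu≼vw with M·-reduct u≢M Mu≼vw
... | unfired _ = ⊥-elim (v≢M refl)
... | fired u≼v u≼w = u≼v , u≼w

·⋠M· : ∀ {u v w} → u ≢ M → ¬ ((u · v) ≼ (M · w))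
·⋠M· u≢M uv≼Mw with ·-reduct u≢M uv≼Mw
... | reduct u≼M _ = u≢M (≼M⇒≡M u≼M)

·-cancel-≼ : ∀ {u v p q} → u ≢ M → (u · v) ≼ (p · q) → u ≼ p × v ≼ q
·-cancel-≼ u≢M uv≼pq with ·-reduct u≢M uv≼pq
... | reduct u≼p v≼q = u≼p , v≼q

InM-suc⇒≢M : ∀ d {t} → InM (suc d) t → t ≢ M
InM-suc⇒≢M d r≼t refl with ≼M⇒≡M r≼t
... | ()

-- The only redex of M·M reproduces M·M, so M(1) = {M·M}.
MM≼⇒≡MM : ∀ {t} → (M · M) ≼ t → t ≡ M · M
MM≼⇒≡MM ε = refl
MM≼⇒≡MM (mock _ ◅ steps) = MM≼⇒≡MM steps
MM≼⇒≡MM (appL _ () ◅ _)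
MM≼⇒≡MM (appR _ () ◅ _)

data InM-View (d : ℕ) : Term → Set where
  M·-in : ∀ {u} → InM (suc d) u → InM-View d (M · u)
  ·-in  : ∀ {u v} → InM (suc d) u → InM (suc d) v → InM-View d (u · v)

InM-view : ∀ d {t} → InM (suc (suc d)) t → InM-View d t
InM-view d r≼t with M·-reduct (InM-suc⇒≢M d ε) r≼t
... | unfired r≼u = M·-in r≼u
... | fired r≼u r≼v = ·-in r≼u r≼v

≼-antisym : ∀ d {s t} → InM (suc d) s → s ≼ t → t ≼ s → s ≡ t
≼-antisym zero s∈ s≼t _ = trans (MM≼⇒≡MM s∈) (sym (MM≼⇒≡MM (s∈ ◅◅ s≼t)))
≼-antisym (suc d) s∈ s≼t t≼s with InM-view d s∈
... | M·-in u∈ with M·-reduct (InM-suc⇒≢M d u∈) s≼t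
...   | unfired u≼u′ =
        cong (M ·_) (≼-antisym d u∈ u≼u′ (M·-cancel-≼ (InM-suc⇒≢M d (u∈ ◅◅ u≼u′)) t≼s))
...   | fired u≼v _ = ⊥-elim (·⋠M· (InM-suc⇒≢M d (u∈ ◅◅ u≼v)) t≼s)
≼-antisym (suc d) s∈ s≼t t≼s | ·-in u∈ v∈ with ·-reduct (InM-suc⇒≢M d u∈) s≼t
... | reduct u≼p v≼q with ·-cancel-≼ (InM-suc⇒≢M d (u∈ ◅◅ u≼p)) t≼s
... | p≼u , q≼v = cong₂ _·_ (≼-antisym d u∈ u≼p p≼u) (≼-antisym d v∈ v≼q q≼v)

record Embedding (d d′ : ℕ) : Set where
  field
    plug           : Term → Term
    plug-injective : Injective _≡_ _≡_ plug
    plug-mono      : plug Preserves _≼_ ⟶ _≼_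
    plug-InM       : ∀ {x} → InM d x → InM d′ (plug x)

module _ {d d′} (E : Embedding d d′) where
  open Embedding E

  Covers-reflect : ∀ {s t} → InM d s → s ≼ t → Covers d′ (plug s) (plug t) → Covers d s t
  Covers-reflect s∈ s≼t (_ , _ , _ , fs≢ft , between) =
    s∈ , s∈ ◅◅ s≼t , s≼t , (λ s≡t → fs≢ft (cong plug s≡t)) ,
    λ x x∈ s≼x x≼t →
      ⊎.map plug-injective plug-injective
        (between (plug x) (plug-InM x∈) (plug-mono s≼x) (plug-mono x≼t))

  Covers-preserve : ∀ {s t} → Covers d s t →
    (∀ {w} → InM d′ w → plug s ≼ w → w ≼ plug t → ∃[ x ] s ≼ x × x ≼ t × w ≡ plug x) →
    Covers d′ (plug s) (plug t)
  Covers-preserve {s} {t} (s∈ , t∈ , s≼t , s≢t , between) interval =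
    plug-InM s∈ , plug-InM t∈ , plug-mono s≼t , (λ e → s≢t (plug-injective e)) , between′
    where
    between′ : ∀ w → InM d′ w → plug s ≼ w → w ≼ plug t → w ≡ plug s ⊎ w ≡ plug t
    between′ w w∈ fs≼w w≼ft with interval w∈ fs≼w w≼ft
    ... | x , s≼x , x≼t , refl =
      ⊎.map (cong plug) (cong plug) (between x (s∈ ◅◅ s≼x) s≼x x≼t)

M·-embedding : ∀ d → Embedding (suc d) (suc (suc d))
M·-embedding d = record
  { plug = M ·_
  ; plug-injective = λ e → proj₂ (·-injective e)
  ; plug-mono = ·-monoʳ-≼ M
  ; plug-InM = ·-monoʳ-≼ M
  }

·ˡ-embedding : ∀ d {v} → InM (suc d) v → Embedding (suc d) (suc (suc d))
·ˡ-embedding d {v} v∈ = record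
  { plug = _· v
  ; plug-injective = λ e → proj₁ (·-injective e)
  ; plug-mono = ·-monoˡ-≼ v
  ; plug-InM = λ x∈ → mock-≼ x∈ v∈
  }

·ʳ-embedding : ∀ d {u} → InM (suc d) u → Embedding (suc d) (suc (suc d))
·ʳ-embedding d {u} u∈ = record
  { plug = u ·_
  ; plug-injective = λ e → proj₂ (·-injective e)
  ; plug-mono = ·-monoʳ-≼ u
  ; plug-InM = λ x∈ → mock-≼ u∈ x∈
  }

Covers-M· : ∀ d {u u′} → Covers (suc d) u u′ → Covers (suc (suc d)) (M · u) (M · u′)
Covers-M· d {u} {u′} c@(u∈ , _) = Covers-preserve (M·-embedding d) c interval
  where
  interval : ∀ {w} → InM (suc (suc d)) w → (M · u) ≼ w → w ≼ (M · u′) →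
             ∃[ x ] u ≼ x × x ≼ u′ × w ≡ M · x
  interval _ Mu≼w w≼Mu′ with M·-reduct (InM-suc⇒≢M d u∈) Mu≼w
  ... | unfired u≼x = _ , u≼x , M·-cancel-≼ (InM-suc⇒≢M d (u∈ ◅◅ u≼x)) w≼Mu′ , refl
  ... | fired u≼v _ = ⊥-elim (·⋠M· (InM-suc⇒≢M d (u∈ ◅◅ u≼v)) w≼Mu′)

Covers-·ˡ : ∀ d {u u′ v} → Covers (suc d) u u′ → InM (suc d) v →
            Covers (suc (suc d)) (u · v) (u′ · v)
Covers-·ˡ d {u} {u′} {v} c@(u∈ , _) v∈ = Covers-preserve (·ˡ-embedding d v∈) c interval
  where
  interval : ∀ {w} → InM (suc (suc d)) w → (u · v) ≼ w → w ≼ (u′ · v) →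
             ∃[ x ] u ≼ x × x ≼ u′ × w ≡ x · v
  interval _ uv≼w w≼u′v with ·-reduct (InM-suc⇒≢M d u∈) uv≼w
  ... | reduct u≼x v≼y with ·-cancel-≼ (InM-suc⇒≢M d (u∈ ◅◅ u≼x)) w≼u′v
  ... | x≼u′ , y≼v with ≼-antisym d v∈ v≼y y≼v
  ... | refl = _ , u≼x , x≼u′ , refl

Covers-·ʳ : ∀ d {u v v′} → InM (suc d) u → Covers (suc d) v v′ →
            Covers (suc (suc d)) (u · v) (u · v′)
Covers-·ʳ d {u} {v} {v′} u∈ c@(v∈ , _) = Covers-preserve (·ʳ-embedding d u∈) c interval
  where
  interval : ∀ {w} → InM (suc (suc d)) w → (u · v) ≼ w → w ≼ (u · v′) →
             ∃[ y ] v ≼ y × y ≼ v′ × w ≡ u · y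
  interval _ uv≼w w≼uv′ with ·-reduct (InM-suc⇒≢M d u∈) uv≼w
  ... | reduct u≼x v≼y with ·-cancel-≼ (InM-suc⇒≢M d (u∈ ◅◅ u≼x)) w≼uv′
  ... | x≼u , y≼v′ with ≼-antisym d u∈ u≼x x≼u
  ... | refl = _ , v≼y , y≼v′ , refl

Covers-mock : ∀ d {u} → InM (suc d) u → Covers (suc (suc d)) (M · u) (u · u)
Covers-mock d {u} u∈ =
  ·-monoʳ-≼ M u∈ , mock-≼ u∈ u∈ , mock-≼ ε ε ,
  (λ e → InM-suc⇒≢M d u∈ (sym (proj₁ (·-injective e)))) , between
  where
  between : ∀ w → InM (suc (suc d)) w → (M · u) ≼ w → w ≼ (u · u) → w ≡ M · u ⊎ w ≡ u · u
  between w _ Mu≼w w≼uu with M·-reduct (InM-suc⇒≢M d u∈) Mu≼w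
  ... | unfired u≼x =
        inj₁ (cong (M ·_) (sym (≼-antisym d u∈ u≼x
          (proj₁ (M·≼·⇒≼ (InM-suc⇒≢M d (u∈ ◅◅ u≼x)) (InM-suc⇒≢M d u∈) w≼uu)))))
  ... | fired u≼v u≼w with ·-cancel-≼ (InM-suc⇒≢M d (u∈ ◅◅ u≼v)) w≼uu
  ... | v≼u , w≼u =
        inj₂ (cong₂ _·_ (sym (≼-antisym d u∈ u≼v v≼u)) (sym (≼-antisym d u∈ u≼w w≼u)))

data CoverView (d : ℕ) : Term → Term → Set where
  M·-cover   : ∀ {u u′} → Covers (suc d) u u′ → CoverView d (M · u) (M · u′)
  mock-cover : ∀ {u} → InM (suc d) u → CoverView d (M · u) (u · u)
  ·ˡ-cover   : ∀ {u u′ v} → Covers (suc d) u u′ → InM (suc d) v → CoverView d (u · v) (u′ · v)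
  ·ʳ-cover   : ∀ {u v v′} → InM (suc d) u → Covers (suc d) v v′ → CoverView d (u · v) (u · v′)

CoverView⇒Covers : ∀ d {s t} → CoverView d s t → Covers (suc (suc d)) s t
CoverView⇒Covers d (M·-cover c)    = Covers-M· d c
CoverView⇒Covers d (mock-cover u∈) = Covers-mock d u∈
CoverView⇒Covers d (·ˡ-cover c v∈) = Covers-·ˡ d c v∈
CoverView⇒Covers d (·ʳ-cover u∈ c) = Covers-·ʳ d u∈ c

-- In each case a suitable intermediate term (u·u, resp. p·v) must be one of the two
-- ends of the cover, which pins down its kind.
Covers⇒CoverView : ∀ d {s t} → Covers (suc (suc d)) s t → CoverView d s t
Covers⇒CoverView d c@(s∈ , _ , s≼t , _ , between) with InM-view d s∈
... | M·-in u∈ with M·-reduct (InM-suc⇒≢M d u∈) s≼t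
...   | unfired u≼u′ = M·-cover (Covers-reflect (M·-embedding d) u∈ u≼u′ c)
...   | fired u≼v u≼w with between _ (mock-≼ u∈ u∈) (mock-≼ ε ε) (·-mono-≼ u≼v u≼w)
...     | inj₁ uu≡Mu = ⊥-elim (InM-suc⇒≢M d u∈ (proj₁ (·-injective uu≡Mu)))
...     | inj₂ refl = mock-cover u∈
Covers⇒CoverView d c@(s∈ , _ , s≼t , _ , between) | ·-in {u} {v} u∈ v∈
  with ·-reduct (InM-suc⇒≢M d u∈) s≼t
... | reduct {p} u≼p v≼q
  with between (p · v) (mock-≼ (u∈ ◅◅ u≼p) v∈) (·-monoˡ-≼ v u≼p) (·-monoʳ-≼ p v≼q)
... | inj₁ pv≡uv with ·-injective pv≡uv
...   | refl , _ = ·ʳ-cover u∈ (Covers-reflect (·ʳ-embedding d u∈) v∈ v≼q c)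
Covers⇒CoverView d c@(s∈ , _ , s≼t , _ , between) | ·-in {u} {v} u∈ v∈
    | reduct {p} u≼p v≼q | inj₂ pv≡pq with ·-injective pv≡pq
...   | _ , refl = ·ˡ-cover (Covers-reflect (·ˡ-embedding d v∈) u∈ u≼p c) v∈

lift-elements : List Term → List Term
lift-elements xs = map (M ·_) xs ++ cartesianProductWith _·_ xs xs

M·-edge : Term × Term → Term × Term
M·-edge (u , u′) = M · u , M · u′

mock-edge : Term → Term × Term
mock-edge u = M · u , u · u

·ˡ-edge : Term × Term → Term → Term × Term
·ˡ-edge (u , u′) v = u · v , u′ · v

·ʳ-edge : Term → Term × Term → Term × Term
·ʳ-edge u (v , v′) = u · v , u · v′

lift-edges : List (Term × Term) → List Term → List (Term × Term)
lift-edges es xs =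
  (map M·-edge es ++ map mock-edge xs) ++
  (cartesianProductWith ·ˡ-edge es xs ++ cartesianProductWith ·ʳ-edge xs es)

-- Shifted by one: elements d and edges d enumerate M(d+1) and its covers.
elements : ℕ → List Term
elements zero    = M · M ∷ []
elements (suc d) = lift-elements (elements d)

edges : ℕ → List (Term × Term)
edges zero    = []
edges (suc d) = lift-edges (edges d) (elements d)

∈-elements⁻ : ∀ d {t} → t ∈ elements d → InM (suc d) t
∈-elements⁻ zero (here refl) = ε
∈-elements⁻ zero (there ())
∈-elements⁻ (suc d) t∈ with ∈-++⁻ (map (M ·_) (elements d)) t∈
... | inj₁ t∈M· with ∈-map⁻ (M ·_) t∈M·
...   | _ , u∈ , refl = ·-monoʳ-≼ M (∈-elements⁻ d u∈)
∈-elements⁻ (suc d) t∈ | inj₂ t∈· with ∈-cartesianProductWith⁻ _·_ (elements d) (elements d) t∈·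
... | _ , _ , u∈ , v∈ , refl = mock-≼ (∈-elements⁻ d u∈) (∈-elements⁻ d v∈)

∈-elements⁺ : ∀ d {t} → InM (suc d) t → t ∈ elements d
∈-elements⁺ zero t∈ = here (MM≼⇒≡MM t∈)
∈-elements⁺ (suc d) t∈ with InM-view d t∈
... | M·-in u∈   = ∈-++⁺ˡ (∈-map⁺ (M ·_) (∈-elements⁺ d u∈))
... | ·-in u∈ v∈ = ∈-++⁺ʳ (map (M ·_) (elements d))
                     (∈-cartesianProductWith⁺ _·_ (∈-elements⁺ d u∈) (∈-elements⁺ d v∈))

∈-elements⇒≢M : ∀ d {t} → t ∈ elements d → t ≢ M
∈-elements⇒≢M d t∈ = InM-suc⇒≢M d (∈-elements⁻ d t∈)

∈-edges⁻ : ∀ d {s t} → (s , t) ∈ edges d → Covers (suc d) s t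
∈-edges⁻ zero ()
∈-edges⁻ (suc d) e∈ = CoverView⇒Covers d (view e∈)
  where
  view : ∀ {s t} → (s , t) ∈ edges (suc d) → CoverView d s t
  view e∈ with ∈-++⁻ (map M·-edge (edges d) ++ map mock-edge (elements d)) e∈
  view e∈ | inj₁ e∈AB with ∈-++⁻ (map M·-edge (edges d)) e∈AB
  ... | inj₁ e∈A with ∈-map⁻ M·-edge e∈A
  ...   | _ , c∈ , refl = M·-cover (∈-edges⁻ d c∈)
  view e∈ | inj₁ e∈AB | inj₂ e∈B with ∈-map⁻ mock-edge e∈B
  ...   | _ , u∈ , refl = mock-cover (∈-elements⁻ d u∈)
  view e∈ | inj₂ e∈CD with ∈-++⁻ (cartesianProductWith ·ˡ-edge (edges d) (elements d)) e∈CD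
  ... | inj₁ e∈C with ∈-cartesianProductWith⁻ ·ˡ-edge (edges d) (elements d) e∈C
  ...   | _ , _ , c∈ , v∈ , refl = ·ˡ-cover (∈-edges⁻ d c∈) (∈-elements⁻ d v∈)
  view e∈ | inj₂ e∈CD | inj₂ e∈D with ∈-cartesianProductWith⁻ ·ʳ-edge (elements d) (edges d) e∈D
  ...   | _ , _ , u∈ , c∈ , refl = ·ʳ-cover (∈-elements⁻ d u∈) (∈-edges⁻ d c∈)

∈-edges⁺ : ∀ d {s t} → Covers (suc d) s t → (s , t) ∈ edges d
∈-edges⁺ zero (s∈ , t∈ , _ , s≢t , _) = ⊥-elim (s≢t (trans (MM≼⇒≡MM s∈) (sym (MM≼⇒≡MM t∈))))
∈-edges⁺ (suc d) c with Covers⇒CoverView d c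
... | M·-cover c′ = ∈-++⁺ˡ (∈-++⁺ˡ (∈-map⁺ M·-edge (∈-edges⁺ d c′)))
... | mock-cover u∈ =
      ∈-++⁺ˡ (∈-++⁺ʳ (map M·-edge (edges d)) (∈-map⁺ mock-edge (∈-elements⁺ d u∈)))
... | ·ˡ-cover c′ v∈ =
      ∈-++⁺ʳ (map M·-edge (edges d) ++ map mock-edge (elements d))
        (∈-++⁺ˡ (∈-cartesianProductWith⁺ ·ˡ-edge (∈-edges⁺ d c′) (∈-elements⁺ d v∈)))
... | ·ʳ-cover u∈ c′ =
      ∈-++⁺ʳ (map M·-edge (edges d) ++ map mock-edge (elements d))
        (∈-++⁺ʳ (cartesianProductWith ·ˡ-edge (edges d) (elements d))
          (∈-cartesianProductWith⁺ ·ʳ-edge (∈-elements⁺ d u∈) (∈-edges⁺ d c′)))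

elements-unique : ∀ d → Unique (elements d)
elements-unique zero = [] ∷ []
elements-unique (suc d) =
  ++⁺ (map⁺ (λ e → proj₂ (·-injective e)) (elements-unique d))
      (cartesianProductWith⁺ _·_ ·-injective (elements-unique d) (elements-unique d))
      M·-disjoint-·
  where
  M·-disjoint-· : Disjoint (map (M ·_) (elements d)) (cartesianProductWith _·_ (elements d) (elements d))
  M·-disjoint-· (Mu∈ , uv∈) with ∈-map⁻ (M ·_) Mu∈
                               | ∈-cartesianProductWith⁻ _·_ (elements d) (elements d) uv∈
  ... | _ , _ , refl | _ , _ , u∈ , _ , Mx≡uv =
        ∈-elements⇒≢M d u∈ (sym (proj₁ (·-injective Mx≡uv)))

-- Edges of the first two blocks start at some M·u, those of the last two at some x·y
-- with x ∈ M(d+1), hence x ≢ M.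
edges-unique : ∀ d → Unique (edges d)
edges-unique zero = []
edges-unique (suc d) =
  ++⁺ (++⁺ (map⁺ M·-edge-injective (edges-unique d))
           (map⁺ mock-edge-injective (elements-unique d))
           M·-disjoint-mock)
      (++⁺ (cartesianProductWith⁺ ·ˡ-edge ·ˡ-edge-injective (edges-unique d) (elements-unique d))
           (cartesianProductWith⁺ ·ʳ-edge ·ʳ-edge-injective (elements-unique d) (edges-unique d))
           ·ˡ-disjoint-·ʳ)
      M·-source-disjoint-·-source
  where
  A B C D : List (Term × Term)
  A  = map M·-edge (edges d)
  B  = map mock-edge (elements d)
  C  = cartesianProductWith ·ˡ-edge (edges d) (elements d)
  D  = cartesianProductWith ·ʳ-edge (elements d) (edges d)

  M·-edge-injective : Injective _≡_ _≡_ M·-edge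
  M·-edge-injective {_ , _} {_ , _} refl = refl

  mock-edge-injective : Injective _≡_ _≡_ mock-edge
  mock-edge-injective refl = refl

  ·ˡ-edge-injective : ∀ {c c′ v v′} → ·ˡ-edge c v ≡ ·ˡ-edge c′ v′ → c ≡ c′ × v ≡ v′
  ·ˡ-edge-injective {_ , _} {_ , _} refl = refl , refl

  ·ʳ-edge-injective : ∀ {u u′ c c′} → ·ʳ-edge u c ≡ ·ʳ-edge u′ c′ → u ≡ u′ × c ≡ c′
  ·ʳ-edge-injective {c = _ , _} {c′ = _ , _} refl = refl , refl

  M·-disjoint-mock : Disjoint A B
  M·-disjoint-mock (e∈A , e∈B) with ∈-map⁻ M·-edge e∈A | ∈-map⁻ mock-edge e∈B
  ... | _ , _ , refl | _ , u∈ , e≡ =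
        ∈-elements⇒≢M d u∈ (sym (proj₁ (·-injective (cong proj₂ e≡))))

  ·ˡ-disjoint-·ʳ : Disjoint C D
  ·ˡ-disjoint-·ʳ (e∈C , e∈D) with ∈-cartesianProductWith⁻ ·ˡ-edge (edges d) (elements d) e∈C
                                | ∈-cartesianProductWith⁻ ·ʳ-edge (elements d) (edges d) e∈D
  ... | _ , _ , c∈ , _ , refl | _ , _ , _ , _ , e≡ =
        proj₁ (proj₂ (proj₂ (proj₂ (∈-edges⁻ d c∈))))
          (trans (proj₁ (·-injective (cong proj₁ e≡))) (sym (proj₁ (·-injective (cong proj₂ e≡)))))

  M·-source : ∀ {e} → e ∈ A ++ B → ∃ λ u → proj₁ e ≡ M · u
  M·-source e∈ with ∈-++⁻ A e∈
  ... | inj₁ e∈A with ∈-map⁻ M·-edge e∈A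
  ...   | _ , _ , refl = _ , refl
  M·-source e∈ | inj₂ e∈B with ∈-map⁻ mock-edge e∈B
  ...   | _ , _ , refl = _ , refl

  ·-source : ∀ {e} → e ∈ C ++ D → ∃₂ λ x y → x ≢ M × proj₁ e ≡ x · y
  ·-source e∈ with ∈-++⁻ C e∈
  ... | inj₁ e∈C with ∈-cartesianProductWith⁻ ·ˡ-edge (edges d) (elements d) e∈C
  ...   | (x , _) , _ , c∈ , _ , refl = _ , _ , InM-suc⇒≢M d (proj₁ (∈-edges⁻ d c∈)) , refl
  ·-source e∈ | inj₂ e∈D with ∈-cartesianProductWith⁻ ·ʳ-edge (elements d) (edges d) e∈D
  ...   | _ , _ , x∈ , _ , refl = _ , _ , ∈-elements⇒≢M d x∈ , refl

  M·-source-disjoint-·-source : Disjoint (A ++ B) (C ++ D)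
  M·-source-disjoint-·-source (e∈AB , e∈CD) with M·-source e∈AB | ·-source e∈CD
  ... | _ , Mu≡ | _ , _ , x≢M , xy≡ = x≢M (sym (proj₁ (·-injective (trans (sym Mu≡) xy≡))))

length-cartesianProductWith : ∀ {A B C : Set} (f : A → B → C) xs ys →
                              length (cartesianProductWith f xs ys) ≡ length xs * length ys
length-cartesianProductWith f []       ys = refl
length-cartesianProductWith f (x ∷ xs) ys =
  trans (length-++ (map (f x) ys))
        (cong₂ _+_ (length-map (f x) ys) (length-cartesianProductWith f xs ys))

length-lift-elements : ∀ xs → length (lift-elements xs) ≡ length xs + length xs * length xs
length-lift-elements xs =
  trans (length-++ (map (M ·_) xs))
        (cong₂ _+_ (length-map (M ·_) xs) (length-cartesianProductWith _·_ xs xs))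

+-comm-square : ∀ m n → (m + n) + (m * n + n * m) ≡ m + n + 2 * m * n
+-comm-square = solve-∀

length-lift-edges : ∀ es xs →
  length (lift-edges es xs) ≡ length es + length xs + 2 * length es * length xs
length-lift-edges es xs = begin
  length (lift-edges es xs)
    ≡⟨ length-++ (map M·-edge es ++ map mock-edge xs) ⟩
  length (map M·-edge es ++ map mock-edge xs) +
  length (cartesianProductWith ·ˡ-edge es xs ++ cartesianProductWith ·ʳ-edge xs es)
    ≡⟨ cong₂ _+_ (length-++ (map M·-edge es)) (length-++ (cartesianProductWith ·ˡ-edge es xs)) ⟩
  (length (map M·-edge es) + length (map mock-edge xs)) +
  (length (cartesianProductWith ·ˡ-edge es xs) + length (cartesianProductWith ·ʳ-edge xs es))
    ≡⟨ cong₂ _+_ (cong₂ _+_ (length-map M·-edge es) (length-map mock-edge xs))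
                 (cong₂ _+_ (length-cartesianProductWith ·ˡ-edge es xs)
                            (length-cartesianProductWith ·ʳ-edge xs es)) ⟩
  (m + n) + (m * n + n * m)
    ≡⟨ +-comm-square m n ⟩
  m + n + 2 * m * n ∎
  where
  open ≡-Reasoning
  m = length es
  n = length xs

length-elements : ∀ d → length (elements d) ≡ b d
length-elements zero = refl
length-elements (suc d) =
  trans (length-lift-elements (elements d))
        (cong₂ (λ n n′ → n + n′ * n′) (length-elements d) (length-elements d))

length-edges : ∀ d → length (edges d) ≡ a d
length-edges zero = refl
length-edges (suc d) =
  trans (length-lift-edges (edges d) (elements d))
        (cong₂ (λ m n → m + n + 2 * m * n) (length-edges d) (length-elements d))

mainTheorem15 : (d : ℕ) → HasseEdgeCount (suc d) (a d)
mainTheorem15 d =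
  edges d ,
  edges-unique d ,
  (λ s t → ∈-edges⁻ d , ∈-edges⁺ d) ,
  length-edges d
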